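{- Let $H$ be a $2$-vertex-connected undirected graph and $T$ a DFS tree of $H$ rooted at $r$. Let $v$ be a vertex and $e$ a tree-edge of $T$ such that $H\setminus\{v,e\}$ is not connected. Then $e$ either lies in the subtree $T(v)$ or lies on the simple tree path $T[v,r]$ from $v$ to $r$.
   Context: $T(v)$ is the subtree of $T$ rooted at $v$; $T[v,r]$ is the tree path from $v$ to the root. $H\setminus\{v,e\}$ is obtained by deleting the vertex $v$ with its incident edges and the edge $e$. -}

module Defs where

open import Data.Nat using (ℕ; _≤_)
open import Data.Fin using (Fin; _≟_)
open import Data.Bool using (Bool; true; false; if_then_else_)
open import Data.List using (List; []; _∷_)
open import Data.Maybe using (Maybe; just; nothing)
open import Data.Product using (Σ; _×_)
open import Data.Sum using (_⊎_)
open import Data.Unit using (⊤)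
open import Relation.Nullary using (¬_)
open import Relation.Nullary.Decidable using (⌊_⌋)
open import Relation.Binary.PropositionalEquality using (_≡_; _≢_)
open import Relation.Binary.Construct.Closure.ReflexiveTransitive using (Star)

record Graph (n : ℕ) : Set where
  field
    adj    : Fin n → Fin n → Bool
    sym    : ∀ x y → adj x y ≡ adj y x
    irrefl : ∀ x → adj x x ≡ false
open Graph public

Edge : ∀ {n} → Graph n → Fin n → Fin n → Set
Edge H x y = adj H x y ≡ true

-- Walks inside a subgraph given by allowed vertices / allowed edges

data Walk {n : ℕ} (okV : Fin n → Set) (okE : Fin n → Fin n → Set)
          : Fin n → Fin n → Set where
  here : ∀ {x} → Walk okV okE x x
  step : ∀ {x y z} → okV x → okV y → okE x y →
         Walk okV okE y z → Walk okV okE x z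

Connected : ∀ {n} → (Fin n → Set) → (Fin n → Fin n → Set) → Set
Connected okV okE = ∀ x y → okV x → okV y → Walk okV okE x y

IsConnected : ∀ {n} → Graph n → Set
IsConnected H = Connected (λ _ → ⊤) (Edge H)

DeleteVertexConnected : ∀ {n} → Graph n → Fin n → Set
DeleteVertexConnected H u = Connected (λ x → x ≢ u) (Edge H)

TwoVertexConnected : ∀ {n} → Graph n → Set
TwoVertexConnected {n} H =
  3 ≤ n × IsConnected H × (∀ u → DeleteVertexConnected H u)

-- H ∖ {v, e} where e = {a, b} is connected
DelVertexEdgeConnected : ∀ {n} → Graph n → Fin n → Fin n → Fin n → Set
DelVertexEdgeConnected H v a b =
  Connected (λ x → x ≢ v)
            (λ x y → Edge H x y × ¬ ((x ≡ a × y ≡ b) ⊎ (x ≡ b × y ≡ a)))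

-- Depth-first search (nondeterministic: any unvisited neighbour may be
-- chosen), modelled as a transition system.

update : ∀ {n} {A : Set} → (Fin n → A) → Fin n → A → Fin n → A
update f w a x = if ⌊ x ≟ w ⌋ then a else f x

record DFSState (n : ℕ) : Set where
  constructor ⟨_,_,_⟩
  field
    stack   : List (Fin n)          -- head = current vertex
    visited : Fin n → Bool
    parent  : Fin n → Maybe (Fin n) -- tree parent (nothing = not yet / root)
open DFSState public

initState : ∀ {n} → Fin n → DFSState n
initState r = ⟨ r ∷ [] , update (λ _ → false) r true , (λ _ → nothing) ⟩

data DFSStep {n : ℕ} (H : Graph n) : DFSState n → DFSState n → Set where
  advance : ∀ {u s vis par w} → Edge H u w → vis w ≡ false →
            DFSStep H ⟨ u ∷ s , vis , par ⟩
                      ⟨ w ∷ u ∷ s , update vis w true , update par w (just u) ⟩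
  retreat : ∀ {u s vis par} → (∀ w → Edge H u w → vis w ≡ true) →
            DFSStep H ⟨ u ∷ s , vis , par ⟩ ⟨ s , vis , par ⟩

DFSRun : ∀ {n} → Graph n → Fin n → Set
DFSRun {n} H r =
  Σ (DFSState n) λ s → Star (DFSStep H) (initState r) s × stack s ≡ []

DFSTree : ∀ {n} {H : Graph n} {r : Fin n} → DFSRun H r → Fin n → Maybe (Fin n)
DFSTree (s Data.Product., _) = parent s

-- Ancestry in a tree given by a parent map.
-- Anc par a x : a is an ancestor of x or a = x, i.e. x ∈ T(a), a ∈ T[x,r].

data Anc {n : ℕ} (par : Fin n → Maybe (Fin n)) (a : Fin n) : Fin n → Set where
  self : Anc par a a
  up   : ∀ {x y} → par x ≡ just y → Anc par a y → Anc par a x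

module Submission where

-- Suppose v is neither an ancestor of p nor a descendant of c.
-- Since neither c nor p is a cut vertex, some edge x₀y₀ ≠ e leaves the subtree
-- T(c).  A DFS tree is a palm tree (every edge at a tree vertex joins it to an
-- ancestor or a descendant), so y₀ is a proper ancestor of c, hence an
-- ancestor of p.  The detour c ⇝ x₀ → y₀ ⇝ p along tree paths avoids v and e,
-- so every walk of H − v can be rerouted around e: H ∖ {v, e} is connected.

open import Defs renaming (sym to adj-sym)
open import Data.Fin using (Fin; zero; suc; _≟_)
open import Data.Nat using (ℕ; zero; suc; _≤_; s≤s)
open import Data.Nat.Properties using (≤-refl; ≤-trans; n≤1+n; 1+n≰n; suc-injective)
open import Data.Bool using (Bool; true; false)
open import Data.List using (List; []; _∷_)
open import Data.List.Relation.Unary.Any using (here; there; any?)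
open import Data.List.Membership.Propositional using (_∈_; _∉_)
open import Data.Maybe using (Maybe; just; nothing)
open import Data.Maybe.Properties using (just-injective)
open import Data.Product using (∃-syntax; _×_; _,_; proj₁; proj₂)
open import Data.Sum using (_⊎_; inj₁; inj₂)
import Data.Sum as Sum
open import Relation.Nullary using (¬_; Dec; yes; no; contradiction)
open import Relation.Nullary.Decidable using (_×-dec_; _⊎-dec_)
open import Relation.Unary using (Decidable)
open import Relation.Binary.PropositionalEquality
  using (_≡_; _≢_; refl; sym; trans; subst; cong)
open import Relation.Binary.Construct.Closure.ReflexiveTransitive using (Star; ε; _◅_)

edge-sym : ∀ {n} (H : Graph n) {x y} → Edge H x y → Edge H y x
edge-sym H {x} {y} xy = trans (adj-sym H y x) xy

just≢nothing : ∀ {A : Set} {a : A} → just a ≢ nothing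
just≢nothing ()

update-same : ∀ {n} {A : Set} (f : Fin n → A) w a → update f w a w ≡ a
update-same f w a with w ≟ w
... | yes _   = refl
... | no w≢w = contradiction refl w≢w

update-other : ∀ {n} {A : Set} (f : Fin n → A) {w} a {x} → x ≢ w → update f w a x ≡ f x
update-other f {w} a {x} x≢w with x ≟ w
... | yes x≡w = contradiction x≡w x≢w
... | no _    = refl

third-vertex : ∀ {n} → 3 ≤ n → (a b : Fin n) → ∃[ w ] w ≢ a × w ≢ b
third-vertex (s≤s (s≤s (s≤s _))) = pick
  where
  pick : ∀ {m} (a b : Fin (suc (suc (suc m)))) → ∃[ w ] w ≢ a × w ≢ b
  pick zero          zero          = suc zero , (λ ()) , (λ ())
  pick zero          (suc zero)    = suc (suc zero) , (λ ()) , (λ ())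
  pick zero          (suc (suc _)) = suc zero , (λ ()) , (λ ())
  pick (suc zero)    zero          = suc (suc zero) , (λ ()) , (λ ())
  pick (suc zero)    (suc _)       = zero , (λ ()) , (λ ())
  pick (suc (suc _)) zero          = suc zero , (λ ()) , (λ ())
  pick (suc (suc _)) (suc _)       = zero , (λ ()) , (λ ())

-- Ancestry in a parent map

Comparable : ∀ {n} → (Fin n → Maybe (Fin n)) → Fin n → Fin n → Set
Comparable par x y = Anc par x y ⊎ Anc par y x

module _ {n} {par : Fin n → Maybe (Fin n)} where

  anc-trans : ∀ {a b x} → Anc par a b → Anc par b x → Anc par a x
  anc-trans ab self        = ab
  anc-trans ab (up px bx)  = up px (anc-trans ab bx)

  -- Two ancestors of the same vertex are comparable (parents are unique).
  anc-comparable : ∀ {a b x} → Anc par a x → Anc par b x → Comparable par a b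
  anc-comparable self        bx          = inj₂ bx
  anc-comparable (up px ay)  self        = inj₁ (up px ay)
  anc-comparable (up px ay)  (up px′ by) with just-injective (trans (sym px) px′)
  ... | refl = anc-comparable ay by

  anc-of-parent : ∀ {a x y} → Anc par a x → a ≢ x → par x ≡ just y → Anc par a y
  anc-of-parent self         a≢x _  = contradiction refl a≢x
  anc-of-parent (up px′ ay′) _   px with just-injective (trans (sym px′) px)
  ... | refl = ay′

-- A depth function decreasing along parent pointers: it makes the parent
-- map acyclic and the ancestor relation decidable.
record Depth {n} (par : Fin n → Maybe (Fin n)) : Set where
  field
    depth        : Fin n → ℕ
    depth-parent : ∀ {x y} → par x ≡ just y → depth x ≡ suc (depth y)

  anc-depth : ∀ {a x} → Anc par a x → depth a ≤ depth x
  anc-depth self                = ≤-refl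
  anc-depth (up {y = y} px ay) =
    ≤-trans (anc-depth ay) (subst (depth y ≤_) (sym (depth-parent px)) (n≤1+n _))

  parent-not-descendant : ∀ {a b} → par a ≡ just b → ¬ Anc par a b
  parent-not-descendant {b = b} pa ab =
    1+n≰n (subst (_≤ depth b) (depth-parent pa) (anc-depth ab))

  -- Decide ancestry by climbing from x; the depth of x bounds the climb.
  anc? : ∀ a x → Dec (Anc par a x)
  anc? a x = climb (depth x) x refl
    where
    climb : ∀ k x → depth x ≡ k → Dec (Anc par a x)
    climb k x dx with a ≟ x | par x in px
    ... | yes refl | _       = yes self
    ... | no a≢x   | nothing = no λ { self     → a≢x refl
                                    ; (up q _) → just≢nothing (trans (sym q) px) }
    climb zero x dx | no a≢x | just y with () ← trans (sym (depth-parent px)) dx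
    climb (suc k) x dx | no a≢x | just y
      with climb k y (suc-injective (trans (sym (depth-parent px)) dx))
    ... | yes ay = yes (up px ay)
    ... | no ¬ay = no λ { self → a≢x refl
                        ; (up q ay) → ¬ay (subst (Anc par a) (just-injective (trans (sym q) px)) ay) }

-- `RootPath par s`: the list s (if nonempty) is the path from its head up
-- to a root.  This is the shape of the DFS stack.
data RootPath {n} (par : Fin n → Maybe (Fin n)) : List (Fin n) → Set where
  empty : RootPath par []
  root  : ∀ {u} → par u ≡ nothing → RootPath par (u ∷ [])
  child : ∀ {u y s} → par u ≡ just y → RootPath par (y ∷ s) → RootPath par (u ∷ y ∷ s)

module _ {n} {par : Fin n → Maybe (Fin n)} where

  rootPath-ancestor : ∀ {u s x} → RootPath par (u ∷ s) → x ∈ u ∷ s → Anc par x u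
  rootPath-ancestor _              (here refl) = self
  rootPath-ancestor (child pu path) (there m)  = up pu (rootPath-ancestor path m)

  rootPath-closed : ∀ {u s a} → RootPath par (u ∷ s) → Anc par a u → a ∈ u ∷ s
  rootPath-closed _               self        = here refl
  rootPath-closed (root pu)       (up pu′ _)  = contradiction (trans (sym pu′) pu) just≢nothing
  rootPath-closed (child pu path) (up pu′ ay) with just-injective (trans (sym pu′) pu)
  ... | refl = there (rootPath-closed path ay)

  rootPath-tail : ∀ {u s} → RootPath par (u ∷ s) → RootPath par s
  rootPath-tail (root _)       = empty
  rootPath-tail (child _ path) = path

  rootPath-cong : ∀ {par′ s} → (∀ {z} → z ∈ s → par′ z ≡ par z) →
                  RootPath par s → RootPath par′ s
  rootPath-cong agree empty           = empty
  rootPath-cong agree (root pu)       = root (trans (agree (here refl)) pu)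
  rootPath-cong agree (child pu path) =
    child (trans (agree (here refl)) pu) (rootPath-cong (λ m → agree (there m)) path)

-- The DFS invariant

-- Invariant of every reachable DFS state.  The key clause `finished-palm`
-- says that a finished vertex (visited, no longer on the stack) is adjacent
-- only to its ancestors and descendants.
record DFSInvariant {n} (H : Graph n) (st : DFSState n) : Set where
  field
    tree-depth       : Depth (parent st)
    parent-edge      : ∀ {x y} → parent st x ≡ just y → Edge H x y
    parent-visited   : ∀ {x y} → parent st x ≡ just y → visited st y ≡ true
    unvisited-orphan : ∀ {x} → visited st x ≡ false → parent st x ≡ nothing
    stack-visited    : ∀ {x} → x ∈ stack st → visited st x ≡ true
    stack-path       : RootPath (parent st) (stack st)
    finished-palm    : ∀ {x y} → visited st x ≡ true → x ∉ stack st →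
                       Edge H x y → Comparable (parent st) x y

  child-visited : ∀ {x y} → parent st x ≡ just y → visited st x ≡ true
  child-visited {x} px with visited st x in vx
  ... | true  = refl
  ... | false = contradiction (trans (sym px) (unvisited-orphan vx)) just≢nothing

init-invariant : ∀ {n} (H : Graph n) r → DFSInvariant H (initState r)
init-invariant H r = record
  { tree-depth       = record { depth = λ _ → 0 ; depth-parent = λ () }
  ; parent-edge      = λ ()
  ; parent-visited   = λ ()
  ; unvisited-orphan = λ _ → refl
  ; stack-visited    = λ { (here refl) → update-same _ r true }
  ; stack-path       = root refl
  ; finished-palm    = finished
  }
  where
  -- initially only r is visited, and it is on the stack
  finished : ∀ {x y} → update (λ _ → false) r true x ≡ true → x ∉ r ∷ [] →
             Edge H x y → Comparable (λ _ → nothing) x y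
  finished {x} vx x∉ _ with x ≟ r
  ... | yes x≡r = contradiction (here x≡r) x∉
  ... | no _    with () ← vx

module Advance {n} (H : Graph n) {u s vis par w}
  (uw : Edge H u w) (w-new : vis w ≡ false)
  (I : DFSInvariant H ⟨ u ∷ s , vis , par ⟩) where

  open DFSInvariant I
  open Depth tree-depth

  vis′ : Fin n → Bool
  vis′ = update vis w true

  par′ : Fin n → Maybe (Fin n)
  par′ = update par w (just u)

  visited≢w : ∀ {z} → vis z ≡ true → z ≢ w
  visited≢w vz refl = contradiction (trans (sym vz) w-new) λ ()

  u≢w : u ≢ w
  u≢w = visited≢w (stack-visited (here refl))

  keeps-visited : ∀ {z} → vis z ≡ true → vis′ z ≡ true
  keeps-visited vz = trans (update-other vis true (visited≢w vz)) vz

  -- Old parent pointers, hence old ancestry, survive (w had no parent).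
  old-parent : ∀ {x y} → par x ≡ just y → par′ x ≡ just y
  old-parent px = trans (update-other par (just u) x≢w) px
    where x≢w = λ { refl → just≢nothing (trans (sym px) (unvisited-orphan w-new)) }

  old-anc : ∀ {a x} → Anc par a x → Anc par′ a x
  old-anc self       = self
  old-anc (up px ay) = up (old-parent px) (old-anc ay)

  new-parent : ∀ {x y} → par′ x ≡ just y → (x ≡ w × y ≡ u) ⊎ (x ≢ w × par x ≡ just y)
  new-parent {x} px with x ≟ w
  ... | yes refl = inj₁ (refl , sym (just-injective px))
  ... | no x≢w   = inj₂ (x≢w , px)

  depth′ : Fin n → ℕ
  depth′ = update depth w (suc (depth u))

  depth′-parent : ∀ {x y} → par′ x ≡ just y → depth′ x ≡ suc (depth′ y)
  depth′-parent px with new-parent px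
  ... | inj₁ (refl , refl) =
    trans (update-same depth w _) (cong suc (sym (update-other depth _ u≢w)))
  ... | inj₂ (x≢w , px)    =
    trans (update-other depth _ x≢w)
          (trans (depth-parent px)
                 (cong suc (sym (update-other depth _ (visited≢w (parent-visited px))))))

  parent-edge′ : ∀ {x y} → par′ x ≡ just y → Edge H x y
  parent-edge′ px with new-parent px
  ... | inj₁ (refl , refl) = edge-sym H uw
  ... | inj₂ (_ , px)      = parent-edge px

  parent-visited′ : ∀ {x y} → par′ x ≡ just y → vis′ y ≡ true
  parent-visited′ px with new-parent px
  ... | inj₁ (refl , refl) = keeps-visited (stack-visited (here refl))
  ... | inj₂ (_ , px)      = keeps-visited (parent-visited px)

  -- the old stack keeps its parent pointers, since its vertices are visited
  stack-path′ : RootPath par′ (w ∷ u ∷ s)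
  stack-path′ = child (update-same par w (just u))
                      (rootPath-cong (λ m → update-other par _ (visited≢w (stack-visited m)))
                                     stack-path)

  orphan′ : ∀ {x} → vis′ x ≡ false → par′ x ≡ nothing
  orphan′ {x} vx with x ≟ w
  ... | yes refl with () ← vx
  ... | no x≢w   = unvisited-orphan vx

  -- w itself is on the stack, so finished vertices are the old ones
  palm′ : ∀ {x y} → vis′ x ≡ true → x ∉ w ∷ u ∷ s → Edge H x y → Comparable par′ x y
  palm′ vx x∉ xy =
    Sum.map old-anc old-anc
      (finished-palm (trans (sym (update-other vis true (λ x≡w → x∉ (here x≡w)))) vx)
                     (λ m → x∉ (there m)) xy)

  invariant : DFSInvariant H ⟨ w ∷ u ∷ s , vis′ , par′ ⟩
  invariant = record
    { tree-depth       = record { depth = depth′ ; depth-parent = depth′-parent }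
    ; parent-edge      = parent-edge′
    ; parent-visited   = parent-visited′
    ; unvisited-orphan = orphan′
    ; stack-visited    = λ { (here refl) → update-same vis w true
                           ; (there m)   → keeps-visited (stack-visited m) }
    ; stack-path       = stack-path′
    ; finished-palm    = palm′
    }

-- Retreating from u, all of whose neighbours are visited, finishes u: each
-- neighbour is an ancestor (on the stack) or an already finished vertex,
-- and a finished neighbour cannot be an ancestor of u, so it is a descendant.
module Retreat {n} (H : Graph n) {u s vis par}
  (done : ∀ y → Edge H u y → vis y ≡ true)
  (I : DFSInvariant H ⟨ u ∷ s , vis , par ⟩) where

  open DFSInvariant I

  palm′ : ∀ {x y} → vis x ≡ true → x ∉ s → Edge H x y → Comparable par x y
  palm′ {x} {y} vx x∉ xy with x ≟ u
  ... | no x≢u = finished-palm vx (λ { (here x≡u) → x≢u x≡u ; (there m) → x∉ m }) xy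
  ... | yes refl with any? (y ≟_) (u ∷ s)
  ...   | yes y∈ = inj₂ (rootPath-ancestor stack-path y∈)
  ...   | no y∉  with finished-palm (done y xy) y∉ (edge-sym H xy)
  ...     | inj₁ y-above-u = contradiction (rootPath-closed stack-path y-above-u) y∉
  ...     | inj₂ u-above-y = inj₁ u-above-y

  invariant : DFSInvariant H ⟨ s , vis , par ⟩
  invariant = record
    { tree-depth       = tree-depth
    ; parent-edge      = parent-edge
    ; parent-visited   = parent-visited
    ; unvisited-orphan = unvisited-orphan
    ; stack-visited    = λ m → stack-visited (there m)
    ; stack-path       = rootPath-tail stack-path
    ; finished-palm    = palm′
    }

run-invariant : ∀ {n} {H : Graph n} {st st′} →
                Star (DFSStep H) st st′ → DFSInvariant H st → DFSInvariant H st′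
run-invariant ε I                          = I
run-invariant (advance uw w-new ◅ steps) I = run-invariant steps (Advance.invariant _ uw w-new I)
run-invariant (retreat done ◅ steps) I     = run-invariant steps (Retreat.invariant _ done I)

record PalmTree {n} (H : Graph n) (par : Fin n → Maybe (Fin n)) : Set where
  field
    tree-depth  : Depth par
    parent-edge : ∀ {x y} → par x ≡ just y → Edge H x y
    palm        : ∀ {x y z} → par x ≡ just y → Edge H x z → Comparable par x z

  open Depth tree-depth public

-- Every DFS tree is a palm tree: at the end the stack is empty, so every
-- tree vertex is finished.
dfs-palm-tree : ∀ {n} (H : Graph n) r (run : DFSRun H r) → PalmTree H (DFSTree run)
dfs-palm-tree H r (st , steps , stack-empty) = record
  { tree-depth  = tree-depth
  ; parent-edge = parent-edge
  ; palm        = λ px → finished-palm (child-visited px) off-stack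
  }
  where
  open DFSInvariant (run-invariant steps (init-invariant H r))
  off-stack : ∀ {x} → x ∉ stack st
  off-stack m with () ← subst (_ ∈_) stack-empty m

-- Walks

module _ {n} {okV : Fin n → Set} where

  _++ʷ_ : ∀ {E x y z} → Walk okV E x y → Walk okV E y z → Walk okV E x z
  here            ++ʷ w′ = w′
  step ox oy e w  ++ʷ w′ = step ox oy e (w ++ʷ w′)

  reverseʷ : ∀ {E} → (∀ {x y} → E x y → E y x) → ∀ {x y} → Walk okV E x y → Walk okV E y x
  reverseʷ E-sym here             = here
  reverseʷ E-sym (step ox oy e w) = reverseʷ E-sym w ++ʷ step oy ox (E-sym e) here

  reroute : ∀ {E E′} → (∀ {x y} → okV x → okV y → E x y → Walk okV E′ x y) →
            ∀ {x y} → Walk okV E x y → Walk okV E′ x y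
  reroute bypass here             = here
  reroute bypass (step ox oy e w) = bypass ox oy e ++ʷ reroute bypass w

  record ExitEdge (E : Fin n → Fin n → Set) (P : Fin n → Set) : Set where
    field
      from to : Fin n
      from-ok : okV from
      to-ok   : okV to
      edge    : E from to
      inside  : P from
      outside : ¬ P to

  exit-edge : ∀ {E P} → Decidable P → ∀ {a b} →
              Walk okV E a b → P a → ¬ P b → ExitEdge E P
  exit-edge P? here Pa ¬Pb = contradiction Pa ¬Pb
  exit-edge P? (step {x} {y} ox oy e w) Px ¬Pb with P? y
  ... | yes Py = exit-edge P? w Py ¬Pb
  ... | no ¬Py = record { from = x ; to = y ; from-ok = ox ; to-ok = oy ; edge = e
                        ; inside = Px ; outside = ¬Py }

tree-walk : ∀ {n} {par : Fin n → Maybe (Fin n)} {okV : Fin n → Set} {E} {a x} →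
            (∀ {z} → Anc par a z → Anc par z x → okV z) →
            (∀ {z y} → par z ≡ just y → Anc par a y → Anc par z x → E z y) →
            Anc par a x → Walk okV E x a
tree-walk okV-on E-on self = here
tree-walk okV-on E-on (up px ay) =
  step (okV-on (up px ay) self) (okV-on ay (up px self)) (E-on px ay self)
       (tree-walk (λ az zy → okV-on az (anc-trans zy (up px self)))
                  (λ pz ay′ zy → E-on pz ay′ (anc-trans zy (up px self))) ay)

-- The detour argument

module Detour {n} (H : Graph n) {par : Fin n → Maybe (Fin n)} (T : PalmTree H par)
  (three : 3 ≤ n) (no-cut : ∀ u → DeleteVertexConnected H u)
  {v c p : Fin n} (c→p : par c ≡ just p) (v∤p : ¬ Anc par v p) (c∤v : ¬ Anc par c v) where

  open PalmTree T

  IsE : Fin n → Fin n → Set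
  IsE x y = (x ≡ c × y ≡ p) ⊎ (x ≡ p × y ≡ c)

  Allowed : Fin n → Fin n → Set
  Allowed x y = Edge H x y × ¬ IsE x y

  W : Fin n → Fin n → Set
  W = Walk (λ x → x ≢ v) Allowed

  allowed-sym : ∀ {x y} → Allowed x y → Allowed y x
  allowed-sym (xy , ¬e) = edge-sym H xy , λ { (inj₁ (a , b)) → ¬e (inj₂ (b , a))
                                            ; (inj₂ (a , b)) → ¬e (inj₁ (b , a)) }

  is-e? : ∀ x y → Dec (IsE x y)
  is-e? x y = ((x ≟ c) ×-dec (y ≟ p)) ⊎-dec ((x ≟ p) ×-dec (y ≟ c))

  c∤p : ¬ Anc par c p
  c∤p = parent-not-descendant c→p

  c≢p : c ≢ p
  c≢p refl = c∤p self

  -- A tree edge z → y other than c → p is allowed (p → c is not a tree edge).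
  allowed-tree-edge : ∀ {z y} → par z ≡ just y → z ≢ c → Allowed z y
  allowed-tree-edge pz z≢c = parent-edge pz , λ
    { (inj₁ (z≡c , _))     → z≢c z≡c
    ; (inj₂ (refl , refl)) → c∤p (up pz self) }

  -- The tree path from x ∈ T(c) up to c avoids v (v ∉ T(c)) and e.
  up-to-c : ∀ {x} → Anc par c x → W x c
  up-to-c = tree-walk (λ cz _ z≡v → c∤v (subst (Anc par c) z≡v cz))
                      (λ pz cy _ → allowed-tree-edge pz λ { refl → parent-not-descendant pz cy })

  -- The tree path from p up to an ancestor y avoids v (v is no ancestor of p) and e.
  up-from-p : ∀ {y} → Anc par y p → W p y
  up-from-p = tree-walk (λ _ zp z≡v → v∤p (subst (λ z → Anc par z p) z≡v zp))
                        (λ pz _ zp → allowed-tree-edge pz λ { refl → c∤p zp })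

  record Escape : Set where
    field
      from to : Fin n
      allowed : Allowed from to
      inside  : Anc par c from
      outside : ¬ Anc par c to

  -- An exit edge of T(c) is allowed once its endpoint conditions rule out
  -- the orientation c → p (the orientation p → c cannot leave T(c)).
  escape-from : ∀ {okV} → ExitEdge {okV = okV} (Edge H) (Anc par c) →
                (∀ {x y} → okV x → okV y → x ≢ c ⊎ y ≢ p) → Escape
  escape-from exit avoids = record
    { from = from ; to = to ; inside = inside ; outside = outside
    ; allowed = edge , λ { (inj₁ (from≡c , to≡p)) → Sum.[ (λ ≢c → ≢c from≡c) , (λ ≢p → ≢p to≡p) ]
                                                     (avoids from-ok to-ok)
                         ; (inj₂ (from≡p , _))   → c∤p (subst (Anc par c) from≡p inside) } }
    where open ExitEdge exit

  -- Neither c nor p is a cut vertex, so such an edge exists: walk in H − p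
  -- from c to a third vertex outside T(c), or in H − c from a third vertex
  -- inside T(c) to p.
  escape : Escape
  escape with third-vertex three c p
  ... | w , w≢c , w≢p with anc? c w
  ...   | no c∤w = escape-from (exit-edge (anc? c) (no-cut p c w c≢p w≢p) self c∤w)
                               (λ _ ≢p → inj₂ ≢p)
  ...   | yes c∣w = escape-from (exit-edge (anc? c) (no-cut c w p w≢c (λ p≡c → c≢p (sym p≡c)))
                                           c∣w c∤p)
                                (λ ≢c _ → inj₁ ≢c)

  open Escape escape

  -- Every vertex of T(c) has a parent, since c has one.
  has-parent : ∀ {x} → Anc par c x → ∃[ y ] par x ≡ just y
  has-parent self       = p , c→p
  has-parent (up px _)  = _ , px

  -- By the palm property the escape edge leads to a proper ancestor of c,
  -- i.e. to an ancestor of p.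
  escape-above-p : Anc par to p
  escape-above-p with palm (proj₂ (has-parent inside)) (proj₁ allowed)
  ... | inj₁ from-above-to = contradiction (anc-trans inside from-above-to) outside
  ... | inj₂ to-above-from with anc-comparable to-above-from inside
  ...   | inj₂ c-above-to = contradiction c-above-to outside
  ...   | inj₁ to-above-c =
    anc-of-parent to-above-c (λ to≡c → outside (subst (Anc par c) (sym to≡c) self)) c→p

  detour : W c p
  detour = reverseʷ allowed-sym (up-to-c inside)
        ++ʷ step (λ from≡v → c∤v (subst (Anc par c) from≡v inside))
                 (λ to≡v → v∤p (subst (λ z → Anc par z p) to≡v escape-above-p)) allowed
                 (reverseʷ allowed-sym (up-from-p escape-above-p))

  -- Every walk of H − v becomes a walk of H ∖ {v, e} by replacing e with the detour.
  connected : DelVertexEdgeConnected H v c p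
  connected x y x≢v y≢v = reroute bypass (no-cut v x y x≢v y≢v)
    where
    bypass : ∀ {a b} → a ≢ v → b ≢ v → Edge H a b → W a b
    bypass {a} {b} a≢v b≢v ab with is-e? a b
    ... | no ¬e                    = step a≢v b≢v (ab , ¬e) here
    ... | yes (inj₁ (refl , refl)) = detour
    ... | yes (inj₂ (refl , refl)) = reverseʷ allowed-sym detour

palm-tree-separation :
  ∀ {n} (H : Graph n) {par : Fin n → Maybe (Fin n)} → PalmTree H par →
  TwoVertexConnected H → (v c p : Fin n) → par c ≡ just p →
  ¬ DelVertexEdgeConnected H v c p → Anc par v p ⊎ Anc par c v
palm-tree-separation H T (three , _ , no-cut) v c p c→p disconnected
  with PalmTree.anc? T v p | PalmTree.anc? T c v
... | yes v-above-p | _             = inj₁ v-above-p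
... | no _          | yes c-above-v = inj₂ c-above-v
... | no v∤p        | no c∤v        =
  contradiction (Detour.connected H T three no-cut c→p v∤p c∤v) disconnected

lemma7 : ∀ {n} (H : Graph n) (r : Fin n) → TwoVertexConnected H →
         (run : DFSRun H r) (v c p : Fin n) → DFSTree run c ≡ just p →
         ¬ DelVertexEdgeConnected H v c p →
         Anc (DFSTree run) v p ⊎ Anc (DFSTree run) c v
lemma7 H r two-connected run = palm-tree-separation H (dfs-palm-tree H r run) two-connected
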